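{- Let $\varphi$ be a formula of order two plus. If $\varphi$ is not intuitionistically provable, then there is a Kripke model of depth at most $2$, whose number of states does not exceed the length of $\varphi$, having a state that does not force $\varphi$.
   Context: A literal is a propositional variable $p$ or a negated variable $\neg p$, where $\neg p$ abbreviates $p\to\bot$; the constant $\bot$ is also allowed in the position of a literal. A formula of order two plus is a formula $\varphi=\xi_1\to\cdots\to\xi_n\to\ell$ ($n\geq0$, $\to$ right-associative) where $\ell$ is a literal or $\bot$ and each $\xi_i=\ell_{i,1}\to\cdots\to\ell_{i,n_i}\to\ell_i$ ($n_i\geq0$) with all $\ell_{i,j},\ell_i$ literals or $\bot$. A Kripke model is $\langle C,\leq,\Vdash\rangle$ with $C$ a nonempty set of states, $\leq$ a partial order, and $\Vdash$ a relation between states and propositional variables that is monotone ($c\leq c'$ and $c\Vdash p$ imply $c'\Vdash p$); forcing is extended by: $c\not\Vdash\bot$; $c\Vdash\varphi\to\psi$ iff for all $c'\geq c$, $c'\Vdash\varphi$ implies $c'\Vdash\psi$ (and the usual clauses for $\land,\lor$). Depth at most $2$ means every strictly increasing chain of states has at most two elements. The length of $\varphi$ is the number of symbol occurrences in $\varphi$. Intuitionistic provability is sound and complete for forcing in all Kripke models. -}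

module Defs where

open import Data.Nat using (ℕ; suc; _+_; _≤_)
open import Data.Fin using (Fin)
open import Data.List using (List; _∷_; [])
open import Data.List.Membership.Propositional using (_∈_)
open import Data.Product using (_×_; Σ; ∃)
open import Data.Sum using (_⊎_)
open import Data.Empty using (⊥)
open import Relation.Binary.PropositionalEquality using (_≡_; _≢_)

infixr 5 _⇒_
infixr 6 _∨'_
infixr 7 _∧'_
data Form : Set where
  var  : ℕ → Form
  bot  : Form
  _⇒_  : Form → Form → Form
  _∧'_ : Form → Form → Form
  _∨'_ : Form → Form → Form

neg : Form → Form
neg φ = φ ⇒ bot

-- Length: number of symbol occurrences (variables, ⊥, connectives;
-- ¬p is literally p → ⊥; parentheses are not counted).
len : Form → ℕ
len (var _)  = 1
len bot      = 1
len (a ⇒ b)  = suc (len a + len b)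
len (a ∧' b) = suc (len a + len b)
len (a ∨' b) = suc (len a + len b)

data Literal : Form → Set where
  lit-var : ∀ p → Literal (var p)
  lit-neg : ∀ p → Literal (neg (var p))
  lit-bot : Literal bot

data LitChain : Form → Set where
  chain-end  : ∀ {ℓ} → Literal ℓ → LitChain ℓ
  chain-cons : ∀ {ℓ ψ} → Literal ℓ → LitChain ψ → LitChain (ℓ ⇒ ψ)

data OrderTwoPlus : Form → Set where
  o2-end  : ∀ {ℓ} → Literal ℓ → OrderTwoPlus ℓ
  o2-cons : ∀ {ξ ψ} → LitChain ξ → OrderTwoPlus ψ → OrderTwoPlus (ξ ⇒ ψ)

infix 3 _⊢_
data _⊢_ (Γ : List Form) : Form → Set where
  hyp   : ∀ {a} → a ∈ Γ → Γ ⊢ a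
  ⇒I    : ∀ {a b} → (a ∷ Γ) ⊢ b → Γ ⊢ a ⇒ b
  ⇒E    : ∀ {a b} → Γ ⊢ a ⇒ b → Γ ⊢ a → Γ ⊢ b
  ∧I    : ∀ {a b} → Γ ⊢ a → Γ ⊢ b → Γ ⊢ a ∧' b
  ∧E₁   : ∀ {a b} → Γ ⊢ a ∧' b → Γ ⊢ a
  ∧E₂   : ∀ {a b} → Γ ⊢ a ∧' b → Γ ⊢ b
  ∨I₁   : ∀ {a b} → Γ ⊢ a → Γ ⊢ a ∨' b
  ∨I₂   : ∀ {a b} → Γ ⊢ b → Γ ⊢ a ∨' b
  ∨E    : ∀ {a b c} → Γ ⊢ a ∨' b → (a ∷ Γ) ⊢ c → (b ∷ Γ) ⊢ c → Γ ⊢ c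
  ⊥E    : ∀ {a} → Γ ⊢ bot → Γ ⊢ a

Provable : Form → Set
Provable φ = [] ⊢ φ

record KripkeModel (k : ℕ) : Set₁ where
  field
    _≼_     : Fin k → Fin k → Set
    ≼-refl  : ∀ c → c ≼ c
    ≼-trans : ∀ {a b c} → a ≼ b → b ≼ c → a ≼ c
    ≼-antisym : ∀ {a b} → a ≼ b → b ≼ a → a ≡ b
    _⊩v_    : Fin k → ℕ → Set
    mono    : ∀ {c c′ p} → c ≼ c′ → c ⊩v p → c′ ⊩v p

open KripkeModel public

forces : ∀ {k} → KripkeModel k → Fin k → Form → Set
forces M c (var p)  = _⊩v_ M c p
forces M c bot      = ⊥
forces M c (a ⇒ b)  = ∀ c′ → _≼_ M c c′ → forces M c′ a → forces M c′ b
forces M c (a ∧' b) = forces M c a × forces M c b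
forces M c (a ∨' b) = forces M c a ⊎ forces M c b

_≺[_]_ : ∀ {k} → Fin k → KripkeModel k → Fin k → Set
a ≺[ M ] b = _≼_ M a b × a ≢ b

DepthAtMost2 : ∀ {k} → KripkeModel k → Set
DepthAtMost2 M = ∀ a b c → a ≺[ M ] b → b ≺[ M ] c → ⊥

-- Write φ = ξ₁ → ⋯ → ξₙ → ℓ, so that ξ₁, …, ξₙ ⊬ ℓ. Enlarge the ξᵢ to a
-- consistent theory T such that a root forcing exactly the atoms derivable
-- from T does not force ℓ (for ℓ = ¬p add p to T). Above the root put, for
-- each atom a occurring as a hypothesis ¬a of some ξᵢ, one classical model of
-- T ∪ {a} if there is one; if not, T ⊢ ¬a by the constructive completeness of
-- classical refutation (Kalmár). The root then forces a hypothesis literal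
-- only if T derives it, and every top world is a model of T, so the root
-- forces each ξᵢ but not ℓ. The model has the root plus at most one state per
-- such hypothesis, hence at most len φ states, and it has depth two.

module Submission where

open import Defs
open import Data.Bool using (Bool; true; false; not; _∧_; _∨_; T)
open import Data.Bool.Properties using (T-∧; T-∨; T-≡)
open import Data.Empty using (⊥; ⊥-elim)
open import Data.Fin using (Fin; zero; suc)
open import Data.List using (List; []; _∷_; _++_; [_]; length; map; concatMap; lookup)
open import Data.List.Properties using (length-++; ++-identityʳ)
open import Data.List.Membership.Propositional using (_∈_; lose)
open import Data.List.Membership.Propositional.Properties
  using (∈-++⁺ˡ; ∈-++⁺ʳ; ∈-concatMap⁺)
open import Data.List.Relation.Binary.Permutation.Propositional using (↭-sym)
open import Data.List.Relation.Binary.Permutation.Propositional.Properties using (shift)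
open import Data.List.Relation.Binary.Subset.Propositional using (_⊆_)
open import Data.List.Relation.Binary.Subset.Propositional.Properties
  using (⊆-reflexive; ⊆-reflexive-↭; xs⊆x∷xs; xs⊆xs++ys; ++⁺ʳ; ∷⁺ʳ)
open import Data.List.Relation.Unary.Any using (here; there; tail)
open import Data.Nat using (ℕ; suc; _+_; _≤_; _<_; z≤n; s≤s; _≟_)
open import Data.Nat.Properties
  using (≤-trans; +-mono-≤; +-mono-≤-<; n≤1+n; m≤n⇒m≤1+n; module ≤-Reasoning)
open import Data.Product using (Σ; _×_; _,_; proj₁; proj₂)
open import Data.Sum using (_⊎_; inj₁; inj₂)
import Data.Sum as Sum
open import Data.Unit using (⊤; tt)
open import Function using (_∘_)
open import Function.Bundles using (Equivalence)
open import Relation.Nullary using (¬_; yes; no)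
open import Relation.Binary.PropositionalEquality using (_≡_; refl; cong)

open Equivalence using (to; from)

weaken : ∀ {Γ Δ ψ} → Γ ⊆ Δ → Γ ⊢ ψ → Δ ⊢ ψ
weaken Γ⊆Δ (hyp ψ∈Γ)  = hyp (Γ⊆Δ ψ∈Γ)
weaken Γ⊆Δ (⇒I d)     = ⇒I (weaken (∷⁺ʳ _ Γ⊆Δ) d)
weaken Γ⊆Δ (⇒E d e)   = ⇒E (weaken Γ⊆Δ d) (weaken Γ⊆Δ e)
weaken Γ⊆Δ (∧I d e)   = ∧I (weaken Γ⊆Δ d) (weaken Γ⊆Δ e)
weaken Γ⊆Δ (∧E₁ d)    = ∧E₁ (weaken Γ⊆Δ d)
weaken Γ⊆Δ (∧E₂ d)    = ∧E₂ (weaken Γ⊆Δ d)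
weaken Γ⊆Δ (∨I₁ d)    = ∨I₁ (weaken Γ⊆Δ d)
weaken Γ⊆Δ (∨I₂ d)    = ∨I₂ (weaken Γ⊆Δ d)
weaken Γ⊆Δ (∨E d e f) = ∨E (weaken Γ⊆Δ d) (weaken (∷⁺ʳ _ Γ⊆Δ) e) (weaken (∷⁺ʳ _ Γ⊆Δ) f)
weaken Γ⊆Δ (⊥E d)     = ⊥E (weaken Γ⊆Δ d)

weaken₁ : ∀ {Γ ψ χ} → Γ ⊢ ψ → χ ∷ Γ ⊢ ψ
weaken₁ = weaken (xs⊆x∷xs _ _)

Valuation : Set
Valuation = ℕ → Bool

eval : Valuation → Form → Bool
eval v (var p)  = v p
eval v bot      = false
eval v (a ⇒ b)  = not (eval v a) ∨ eval v b
eval v (a ∧' b) = eval v a ∧ eval v b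
eval v (a ∨' b) = eval v a ∨ eval v b

infix 4 _⊨_
_⊨_ : Valuation → List Form → Set
v ⊨ Γ = ∀ {ψ} → ψ ∈ Γ → T (eval v ψ)

Satisfiable : List Form → Set
Satisfiable Γ = Σ Valuation (_⊨ Γ)

⊨-∷ : ∀ {v Γ ψ} → T (eval v ψ) → v ⊨ Γ → v ⊨ ψ ∷ Γ
⊨-∷ t v⊨Γ (here refl)  = t
⊨-∷ t v⊨Γ (there ψ∈Γ) = v⊨Γ ψ∈Γ

T-modus-ponens : ∀ a {b} → T (not a ∨ b) → T a → T b
T-modus-ponens true t _ = t

sound : ∀ {Γ ψ v} → v ⊨ Γ → Γ ⊢ ψ → T (eval v ψ)
sound v⊨Γ (hyp ψ∈Γ) = v⊨Γ ψ∈Γ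
sound {v = v} v⊨Γ (⇒I {a} d) with eval v a in eval≡
... | true  = sound (⊨-∷ (from T-≡ eval≡) v⊨Γ) d
... | false = tt
sound {v = v} v⊨Γ (⇒E {a} d e) = T-modus-ponens (eval v a) (sound v⊨Γ d) (sound v⊨Γ e)
sound v⊨Γ (∧I d e) = from T-∧ (sound v⊨Γ d , sound v⊨Γ e)
sound v⊨Γ (∧E₁ d)  = proj₁ (to T-∧ (sound v⊨Γ d))
sound v⊨Γ (∧E₂ d)  = proj₂ (to T-∧ (sound v⊨Γ d))
sound v⊨Γ (∨I₁ d)  = from T-∨ (inj₁ (sound v⊨Γ d))
sound v⊨Γ (∨I₂ d)  = from T-∨ (inj₂ (sound v⊨Γ d))
sound v⊨Γ (∨E d e f) with to T-∨ (sound v⊨Γ d)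
... | inj₁ ta = sound (⊨-∷ ta v⊨Γ) e
... | inj₂ tb = sound (⊨-∷ tb v⊨Γ) f
sound v⊨Γ (⊥E d) with () ← sound v⊨Γ d

-- Kalmár's lemma and the completeness of classical refutation

signed : Bool → Form → Form
signed true  ψ = ψ
signed false ψ = neg ψ

vars : Form → List ℕ
vars (var p)  = [ p ]
vars bot      = []
vars (a ⇒ b)  = vars a ++ vars b
vars (a ∧' b) = vars a ++ vars b
vars (a ∨' b) = vars a ++ vars b

Assignment : Set
Assignment = List (ℕ × Bool)

dom : Assignment → List ℕ
dom = map proj₁

literals : Assignment → List Form
literals = map λ (p , b) → signed b (var p)

-- Atoms outside the domain are false; of two entries for one atom, the first wins.
⟦_⟧ : Assignment → Valuation
⟦ [] ⟧          p = false
⟦ (q , b) ∷ σ ⟧ p with p ≟ q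
... | yes _ = b
... | no  _ = ⟦ σ ⟧ p

assigned-literal : ∀ σ {p} → p ∈ dom σ → literals σ ⊢ signed (⟦ σ ⟧ p) (var p)
assigned-literal ((q , b) ∷ σ) {p} p∈ with p ≟ q
... | yes refl = hyp (here refl)
... | no  p≢q  = weaken₁ (assigned-literal σ (tail p≢q p∈))

kalmar : ∀ σ ψ → vars ψ ⊆ dom σ → literals σ ⊢ signed (eval ⟦ σ ⟧ ψ) ψ
kalmar σ (var p) cov = assigned-literal σ (cov (here refl))
kalmar σ bot     cov = ⇒I (hyp (here refl))
kalmar σ (a ⇒ b) cov
  with eval ⟦ σ ⟧ a | kalmar σ a (cov ∘ ∈-++⁺ˡ) | eval ⟦ σ ⟧ b | kalmar σ b (cov ∘ ∈-++⁺ʳ _)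
... | false | ⊢¬a | _     | _   = ⇒I (⊥E (⇒E (weaken₁ ⊢¬a) (hyp (here refl))))
... | true  | _   | true  | ⊢b  = ⇒I (weaken₁ ⊢b)
... | true  | ⊢a  | false | ⊢¬b = ⇒I (⇒E (weaken₁ ⊢¬b) (⇒E (hyp (here refl)) (weaken₁ ⊢a)))
kalmar σ (a ∧' b) cov
  with eval ⟦ σ ⟧ a | kalmar σ a (cov ∘ ∈-++⁺ˡ) | eval ⟦ σ ⟧ b | kalmar σ b (cov ∘ ∈-++⁺ʳ _)
... | false | ⊢¬a | _     | _   = ⇒I (⇒E (weaken₁ ⊢¬a) (∧E₁ (hyp (here refl))))
... | true  | _   | false | ⊢¬b = ⇒I (⇒E (weaken₁ ⊢¬b) (∧E₂ (hyp (here refl))))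
... | true  | ⊢a  | true  | ⊢b  = ∧I ⊢a ⊢b
kalmar σ (a ∨' b) cov
  with eval ⟦ σ ⟧ a | kalmar σ a (cov ∘ ∈-++⁺ˡ) | eval ⟦ σ ⟧ b | kalmar σ b (cov ∘ ∈-++⁺ʳ _)
... | true  | ⊢a  | _     | _   = ∨I₁ ⊢a
... | false | _   | true  | ⊢b  = ∨I₂ ⊢b
... | false | ⊢¬a | false | ⊢¬b =
  ⇒I (∨E (hyp (here refl)) (⇒E (weaken₁ (weaken₁ ⊢¬a)) (hyp (here refl)))
                           (⇒E (weaken₁ (weaken₁ ⊢¬b)) (hyp (here refl))))

Covers : List ℕ → List Form → Set
Covers ps Δ = ∀ {δ} → δ ∈ Δ → vars δ ⊆ ps

satisfied-or-refuted : ∀ σ Δ → Covers (dom σ) Δ → ⟦ σ ⟧ ⊨ Δ ⊎ literals σ ++ Δ ⊢ bot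
satisfied-or-refuted σ []      cov = inj₁ λ ()
satisfied-or-refuted σ (δ ∷ Δ) cov
  with eval ⟦ σ ⟧ δ in eval≡ | kalmar σ δ (cov (here refl))
... | false | ⊢¬δ = inj₂ (⇒E (weaken (xs⊆xs++ys _ _) ⊢¬δ) (hyp (∈-++⁺ʳ _ (here refl))))
... | true  | _ with satisfied-or-refuted σ Δ (cov ∘ there)
...   | inj₁ ⊨Δ = inj₁ (⊨-∷ (from T-≡ eval≡) ⊨Δ)
...   | inj₂ ⊢⊥ = inj₂ (weaken (++⁺ʳ _ (xs⊆x∷xs _ _)) ⊢⊥)

satisfiable-or-refutable-under : ∀ Δ ps σ → Covers (ps ++ dom σ) Δ → Satisfiable Δ ⊎ literals σ ++ Δ ⊢ bot
satisfiable-or-refutable-under Δ [] σ cov with satisfied-or-refuted σ Δ cov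
... | inj₁ ⊨Δ = inj₁ (⟦ σ ⟧ , ⊨Δ)
... | inj₂ ⊢⊥ = inj₂ ⊢⊥
satisfiable-or-refutable-under Δ (p ∷ ps) σ cov
  with satisfiable-or-refutable-under Δ ps ((p , true) ∷ σ) (λ δ∈Δ → reassign ∘ cov δ∈Δ)
     | satisfiable-or-refutable-under Δ ps ((p , false) ∷ σ) (λ δ∈Δ → reassign ∘ cov δ∈Δ)
  where
  reassign : p ∷ ps ++ dom σ ⊆ ps ++ p ∷ dom σ
  reassign = ⊆-reflexive-↭ (↭-sym (shift p ps (dom σ)))
... | inj₁ sat | _       = inj₁ sat
... | inj₂ _   | inj₁ sat = inj₁ sat
... | inj₂ p⊢⊥ | inj₂ ¬p⊢⊥ = inj₂ (⇒E (⇒I ¬p⊢⊥) (⇒I p⊢⊥))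

satisfiable-or-refutable : ∀ Δ → Satisfiable Δ ⊎ Δ ⊢ bot
satisfiable-or-refutable Δ =
  satisfiable-or-refutable-under Δ (concatMap vars Δ) [] λ δ∈Δ p∈δ → ∈-++⁺ˡ (∈-concatMap⁺ vars (lose δ∈Δ p∈δ))

-- Kripke models with a root below finitely many classical valuations

infix 4 _⊑_
_⊑_ : ∀ {n} → Fin (suc n) → Fin (suc n) → Set
zero  ⊑ _     = ⊤
suc i ⊑ zero  = ⊥
suc i ⊑ suc j = i ≡ j

⊑-refl : ∀ {n} (c : Fin (suc n)) → c ⊑ c
⊑-refl zero    = tt
⊑-refl (suc i) = refl

⊑-trans : ∀ {n} {a b c : Fin (suc n)} → a ⊑ b → b ⊑ c → a ⊑ c
⊑-trans {a = zero}                  _    _    = tt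
⊑-trans {a = suc i} {suc j} {suc k} refl refl = refl

⊑-antisym : ∀ {n} {a b : Fin (suc n)} → a ⊑ b → b ⊑ a → a ≡ b
⊑-antisym {a = zero}  {zero}  _    _ = refl
⊑-antisym {a = suc i} {suc j} refl _ = refl

module Fan (R : ℕ → Set) (W : List Valuation)
           (R⇒W : ∀ i {p} → R p → T (lookup W i p)) where

  _⊩ᵛ_ : Fin (suc (length W)) → ℕ → Set
  zero  ⊩ᵛ p = R p
  suc i ⊩ᵛ p = T (lookup W i p)

  ⊩ᵛ-mono : ∀ {c c′ p} → c ⊑ c′ → c ⊩ᵛ p → c′ ⊩ᵛ p
  ⊩ᵛ-mono {zero}  {zero}  _    r = r
  ⊩ᵛ-mono {zero}  {suc j} _    r = R⇒W j r
  ⊩ᵛ-mono {suc i} {suc j} refl t = t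

  model : KripkeModel (suc (length W))
  model = record
    { _≼_ = _⊑_ ; ≼-refl = ⊑-refl ; ≼-trans = ⊑-trans ; ≼-antisym = ⊑-antisym
    ; _⊩v_ = _⊩ᵛ_ ; mono = ⊩ᵛ-mono }

  depth≤2 : DepthAtMost2 model
  depth≤2 zero    zero    _       (_ , a≢b) _          = a≢b refl
  depth≤2 (suc i) zero    _       (() , _)  _
  depth≤2 _       (suc i) (suc j) _         (i≡j , b≢c) = b≢c (cong suc i≡j)

  forces-top⇒eval : ∀ i ψ → forces model (suc i) ψ → T (eval (lookup W i) ψ)
  eval⇒forces-top : ∀ i ψ → T (eval (lookup W i) ψ) → forces model (suc i) ψ

  forces-top⇒eval i (var p) f = f
  forces-top⇒eval i (a ⇒ b) f with eval (lookup W i) a in eval≡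
  ... | true  = forces-top⇒eval i b (f (suc i) refl (eval⇒forces-top i a (from T-≡ eval≡)))
  ... | false = tt
  forces-top⇒eval i (a ∧' b) (fa , fb) = from T-∧ (forces-top⇒eval i a fa , forces-top⇒eval i b fb)
  forces-top⇒eval i (a ∨' b) (inj₁ fa) = from T-∨ (inj₁ (forces-top⇒eval i a fa))
  forces-top⇒eval i (a ∨' b) (inj₂ fb) = from T-∨ (inj₂ (forces-top⇒eval i b fb))

  eval⇒forces-top i (var p) t = t
  eval⇒forces-top i (a ⇒ b) t (suc j) refl fa =
    eval⇒forces-top i b (T-modus-ponens _ t (forces-top⇒eval i a fa))
  eval⇒forces-top i (a ∧' b) t =
    let ta , tb = to T-∧ t in eval⇒forces-top i a ta , eval⇒forces-top i b tb
  eval⇒forces-top i (a ∨' b) t = Sum.map (eval⇒forces-top i a) (eval⇒forces-top i b) (to T-∨ t)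

premises : ∀ {φ} → OrderTwoPlus φ → List Form
premises (o2-end _)        = []
premises (o2-cons {ξ} _ o) = ξ ∷ premises o

conclusion : ∀ {φ} → OrderTwoPlus φ → Form
conclusion (o2-end {ℓ} _) = ℓ
conclusion (o2-cons _ o)  = conclusion o

conclusion-literal : ∀ {φ} (o : OrderTwoPlus φ) → Literal (conclusion o)
conclusion-literal (o2-end l)    = l
conclusion-literal (o2-cons _ o) = conclusion-literal o

discharge-premises : ∀ {φ} (o : OrderTwoPlus φ) Γ → Γ ++ premises o ⊢ conclusion o → Γ ⊢ φ
discharge-premises (o2-end _)          Γ d = weaken (⊆-reflexive (++-identityʳ Γ)) d
discharge-premises (o2-cons {ξ} _ o) Γ d =
  ⇒I (discharge-premises o (ξ ∷ Γ) (weaken (⊆-reflexive-↭ (shift ξ Γ (premises o))) d))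

⊬conclusion : ∀ {φ} (o : OrderTwoPlus φ) → ¬ Provable φ → ¬ (premises o ⊢ conclusion o)
⊬conclusion o ⊬φ = ⊬φ ∘ discharge-premises o []

negated-atom : ∀ {ℓ} → Literal ℓ → List ℕ
negated-atom (lit-neg p) = [ p ]
negated-atom _           = []

negated-hypotheses : ∀ {ξ} → LitChain ξ → List ℕ
negated-hypotheses (chain-end _)    = []
negated-hypotheses (chain-cons l c) = negated-atom l ++ negated-hypotheses c

negated-premise-hypotheses : ∀ {φ} → OrderTwoPlus φ → List ℕ
negated-premise-hypotheses (o2-end _)    = []
negated-premise-hypotheses (o2-cons c o) = negated-hypotheses c ++ negated-premise-hypotheses o

len-positive : ∀ ψ → 0 < len ψ
len-positive (var _)  = s≤s z≤n
len-positive bot      = s≤s z≤n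
len-positive (_ ⇒ _)  = s≤s z≤n
len-positive (_ ∧' _) = s≤s z≤n
len-positive (_ ∨' _) = s≤s z≤n

length-negated-atom : ∀ {ℓ} (l : Literal ℓ) → length (negated-atom l) ≤ len ℓ
length-negated-atom (lit-var _) = z≤n
length-negated-atom (lit-neg _) = s≤s z≤n
length-negated-atom lit-bot     = z≤n

length-negated-hypotheses : ∀ {ξ} (c : LitChain ξ) → length (negated-hypotheses c) ≤ len ξ
length-negated-hypotheses (chain-end _) = z≤n
length-negated-hypotheses (chain-cons {ℓ} {ψ} l c) = begin
  length (negated-atom l ++ negated-hypotheses c)           ≡⟨ length-++ (negated-atom l) ⟩
  length (negated-atom l) + length (negated-hypotheses c)  ≤⟨ +-mono-≤ (length-negated-atom l)
                                                                        (length-negated-hypotheses c) ⟩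
  len ℓ + len ψ                                             ≤⟨ n≤1+n _ ⟩
  len (ℓ ⇒ ψ)                                               ∎
  where open ≤-Reasoning

length-negated-premise-hypotheses :
  ∀ {φ} (o : OrderTwoPlus φ) → length (negated-premise-hypotheses o) < len φ
length-negated-premise-hypotheses (o2-end {ℓ} _) = len-positive ℓ
length-negated-premise-hypotheses (o2-cons {ξ} {ψ} c o) = begin-strict
  length (negated-hypotheses c ++ negated-premise-hypotheses o)
    ≡⟨ length-++ (negated-hypotheses c) ⟩
  length (negated-hypotheses c) + length (negated-premise-hypotheses o)
    <⟨ +-mono-≤-< (length-negated-hypotheses c) (length-negated-premise-hypotheses o) ⟩
  len ξ + len ψ
    ≤⟨ n≤1+n _ ⟩
  len (ξ ⇒ ψ)
    ∎
  where open ≤-Reasoning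

-- What a theory needs for the root of a fan over it not to force the literal.
RootRefutes : ∀ {ℓ} → List Form → Literal ℓ → Set
RootRefutes Γ (lit-var p) = ¬ (Γ ⊢ var p)
RootRefutes Γ (lit-neg p) = Γ ⊢ var p
RootRefutes Γ lit-bot     = ⊤

record RefutingExtension (Γ : List Form) {ℓ} (l : Literal ℓ) : Set where
  field
    theory     : List Form
    consistent : ¬ (theory ⊢ bot)
    extends    : Γ ⊆ theory
    refutes    : RootRefutes theory l

refuting-extension : ∀ {Γ ℓ} (l : Literal ℓ) → ¬ (Γ ⊢ ℓ) → RefutingExtension Γ l
refuting-extension {Γ} (lit-var p) Γ⊬p = record
  { theory = Γ ; consistent = Γ⊬p ∘ ⊥E ; extends = λ ψ∈Γ → ψ∈Γ ; refutes = Γ⊬p }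
refuting-extension {Γ} (lit-neg p) Γ⊬¬p = record
  { theory = var p ∷ Γ ; consistent = Γ⊬¬p ∘ ⇒I ; extends = there ; refutes = hyp (here refl) }
refuting-extension {Γ} lit-bot Γ⊬⊥ = record
  { theory = Γ ; consistent = Γ⊬⊥ ; extends = λ ψ∈Γ → ψ∈Γ ; refutes = tt }

Settled : List Form → List Valuation → ℕ → Set
Settled Γ W a = Γ ⊢ neg (var a) ⊎ Σ (Fin (length W)) λ i → T (lookup W i a)

record TopWorlds (Γ : List Form) (as : List ℕ) : Set where
  field
    worlds  : List Valuation
    few     : length worlds ≤ length as
    models  : ∀ i → lookup worlds i ⊨ Γ
    settles : ∀ {a} → a ∈ as → Settled Γ worlds a

top-worlds : ∀ Γ as → TopWorlds Γ as
top-worlds Γ [] = record { worlds = [] ; few = z≤n ; models = λ () ; settles = λ () }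
top-worlds Γ (a ∷ as) with top-worlds Γ as | satisfiable-or-refutable (var a ∷ Γ)
... | tops | inj₁ (v , v⊨a∷Γ) = record
  { worlds  = v ∷ worlds
  ; few     = s≤s few
  ; models  = λ { zero → v⊨a∷Γ ∘ there ; (suc i) → models i }
  ; settles = λ { (here refl) → inj₂ (zero , v⊨a∷Γ (here refl))
                ; (there a∈as) → Sum.map₂ (λ (i , t) → suc i , t) (settles a∈as) } }
  where open TopWorlds tops
... | tops | inj₂ a∷Γ⊢⊥ = record
  { worlds  = worlds
  ; few     = m≤n⇒m≤1+n few
  ; models  = models
  ; settles = λ { (here refl) → inj₁ (⇒I a∷Γ⊢⊥) ; (there a∈as) → settles a∈as } }
  where open TopWorlds tops

module Countermodel (Γ : List Form) (consistent : ¬ (Γ ⊢ bot))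
                    (W : List Valuation) (models : ∀ i → lookup W i ⊨ Γ) where

  open Fan (λ p → Γ ⊢ var p) W (λ i → sound (models i)) public

  root : Fin (suc (length W))
  root = zero

  AllSettled : List ℕ → Set
  AllSettled as = ∀ {a} → a ∈ as → Settled Γ W a

  derivable⇒forced-at-top : ∀ i {ψ} → Γ ⊢ ψ → forces model (suc i) ψ
  derivable⇒forced-at-top i {ψ} d = eval⇒forces-top i ψ (sound (models i) d)

  derivable⇒forced-at-root : ∀ {ℓ} → Literal ℓ → Γ ⊢ ℓ → forces model root ℓ
  derivable⇒forced-at-root (lit-var p) ⊢p = ⊢p
  derivable⇒forced-at-root lit-bot     ⊢⊥ = consistent ⊢⊥
  derivable⇒forced-at-root (lit-neg p) ⊢¬p zero    _ ⊢p = consistent (⇒E ⊢¬p ⊢p)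
  derivable⇒forced-at-root (lit-neg p) ⊢¬p (suc i) _ ⊩p =
    derivable⇒forced-at-top i ⊢¬p (suc i) refl ⊩p

  forced-at-root⇒derivable :
    ∀ {ℓ} (l : Literal ℓ) → AllSettled (negated-atom l) → forces model root ℓ → Γ ⊢ ℓ
  forced-at-root⇒derivable (lit-var p) _ ⊢p = ⊢p
  forced-at-root⇒derivable (lit-neg p) settled ⊩¬p with settled (here refl)
  ... | inj₁ ⊢¬p   = ⊢¬p
  ... | inj₂ (i , t) = ⊥-elim (⊩¬p (suc i) tt t)

  chain-forced-at-root :
    ∀ {ξ} (c : LitChain ξ) → AllSettled (negated-hypotheses c) → Γ ⊢ ξ → forces model root ξ
  chain-forced-at-root (chain-end l) _ ⊢ℓ = derivable⇒forced-at-root l ⊢ℓ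
  chain-forced-at-root (chain-cons l c) settled ⊢ℓ⇒ψ zero _ ⊩ℓ =
    chain-forced-at-root c (settled ∘ ∈-++⁺ʳ _)
      (⇒E ⊢ℓ⇒ψ (forced-at-root⇒derivable l (settled ∘ ∈-++⁺ˡ) ⊩ℓ))
  chain-forced-at-root (chain-cons l c) _ ⊢ℓ⇒ψ (suc i) _ ⊩ℓ =
    derivable⇒forced-at-top i ⊢ℓ⇒ψ (suc i) refl ⊩ℓ

  conclusion-forced-at-root :
    ∀ {φ} (o : OrderTwoPlus φ) → premises o ⊆ Γ → AllSettled (negated-premise-hypotheses o) →
    forces model root φ → forces model root (conclusion o)
  conclusion-forced-at-root (o2-end _) _ _ ⊩φ = ⊩φ
  conclusion-forced-at-root (o2-cons c o) premises⊆Γ settled ⊩ξ⇒ψ =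
    conclusion-forced-at-root o (premises⊆Γ ∘ there) (settled ∘ ∈-++⁺ʳ _)
      (⊩ξ⇒ψ zero tt (chain-forced-at-root c (settled ∘ ∈-++⁺ˡ) (hyp (premises⊆Γ (here refl)))))

  root-refutes : ∀ {ℓ} (l : Literal ℓ) → RootRefutes Γ l → ¬ forces model root ℓ
  root-refutes (lit-var p) Γ⊬p ⊢p = Γ⊬p ⊢p
  root-refutes (lit-neg p) ⊢p  ⊩¬p = ⊩¬p zero tt ⊢p

lemma5p5 : (φ : Form) → OrderTwoPlus φ → ¬ Provable φ →
    Σ ℕ (λ k → k ≤ len φ × Σ (KripkeModel k) (λ M →
    DepthAtMost2 M × Σ (Fin k) (λ c → ¬ forces M c φ)))
lemma5p5 φ o ⊬φ =
  suc (length worlds) , ≤-trans (s≤s few) (length-negated-premise-hypotheses o) ,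
  model , depth≤2 , root ,
  root-refutes (conclusion-literal o) refutes ∘ conclusion-forced-at-root o extends settles
  where
  open RefutingExtension (refuting-extension (conclusion-literal o) (⊬conclusion o ⊬φ))
  open TopWorlds (top-worlds theory (negated-premise-hypotheses o))
  open Countermodel theory consistent worlds models
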